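{- Let $K$ be a connected cactus, and fix a depth-first search of $K$ started at a vertex $r$; let $\mathrm{DFN}(x)$ be the position of $x$ in the resulting DFS order ($\mathrm{DFN}(r)=0$) and $\mathrm{FATHER}(x)$ the predecessor of $x\neq r$ in the DFS tree. For a cycle $C$ of $K$, its root is the vertex of $C$ with smallest $\mathrm{DFN}$. Suppose the last vertex $l$ in the DFS order lies on a cycle $C$. Then: (1) the neighbour of $l$ on $C$ which is not $\mathrm{FATHER}(l)$ is the root of $C$; (2) $l$ is not a hinge (i.e. $l$ does not have degree $\ge 3$); (3) if $w,v\in V(C)$ with $w=\mathrm{FATHER}(v)$, $w$ is not the root of $C$, $w$ is a hinge, and $\widetilde K$ is a connected subgraph (subcactus) of $K$ containing $w$ with $V(C)\cap V(\widetilde K)=\{w\}$, then every $\widetilde v\in V(\widetilde K)$ satisfies $\mathrm{DFN}(w)\le \mathrm{DFN}(\widetilde v)<\mathrm{DFN}(v)$.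
   Context: A cactus is a connected graph in which any two cycles share at most one vertex. A hinge is a vertex lying on at least one cycle and having degree at least $3$. -}

module Defs where

open import Data.Nat using (ℕ; _≤_; _<_)
open import Data.Fin using (Fin; toℕ)
open import Data.Bool using (Bool; true; false; T)
open import Data.List using (List; []; _∷_; _++_; [_]; length; filter; allFin)
open import Data.List.Membership.Propositional using (_∈_)
open import Data.List.Relation.Unary.Unique.Propositional using (Unique)
open import Data.Product using (Σ; ∃; ∃-syntax; _×_)
open import Data.Sum using (_⊎_)
open import Relation.Nullary using (¬_)
open import Relation.Binary.PropositionalEquality using (_≡_; _≢_)
open import Function using (Injective; _⇔_)
open import Data.Bool.Properties using (T?)

record Graph (n : ℕ) : Set where
  field
    adj    : Fin n → Fin n → Bool
    sym    : ∀ x y → adj x y ≡ adj y x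
    irrefl : ∀ x → adj x x ≡ false

module _ {n : ℕ} (G : Graph n) where
  open Graph G

  Adj : Fin n → Fin n → Set
  Adj x y = T (adj x y)

  degree : Fin n → ℕ
  degree x = length (filter (λ y → T? (adj x y)) (allFin n))

data Walk {n : ℕ} (E : Fin n → Fin n → Set) : Fin n → Fin n → Set where
  here : ∀ {x} → Walk E x x
  step : ∀ {x y z} → E x y → Walk E y z → Walk E x z

module _ {n : ℕ} (G : Graph n) where

  Connected : Set
  Connected = ∀ x y → Walk (Adj G) x y

  data Chain : List (Fin n) → Set where
    nil  : Chain []
    one  : ∀ x → Chain [ x ]
    cons : ∀ x y xs → Adj G x y → Chain (y ∷ xs) → Chain (x ∷ y ∷ xs)

  record Cycle : Set where
    field
      first  : Fin n
      rest   : List (Fin n)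
      long   : 2 ≤ length rest
      uniq   : Unique (first ∷ rest)
      closed : Chain (first ∷ rest ++ [ first ])

  _∈C_ : Fin n → Cycle → Set
  u ∈C C = u ∈ (Cycle.first C ∷ Cycle.rest C)

  Consec : Fin n → Fin n → List (Fin n) → Set
  Consec u v ws = Σ (List (Fin n)) λ as → Σ (List (Fin n)) λ bs → ws ≡ as ++ u ∷ v ∷ bs

  CycleEdge : Cycle → Fin n → Fin n → Set
  CycleEdge C u v = Consec u v ws ⊎ Consec v u ws
    where ws = Cycle.first C ∷ Cycle.rest C ++ [ Cycle.first C ]

  -- any two distinct cycles share at most one vertex: two cycles sharing
  -- two distinct vertices are the same cycle (same edge set)
  Cactus : Set
  Cactus = Connected × (∀ (C D : Cycle) (a b : Fin n) → a ≢ b →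
             a ∈C C → b ∈C C → a ∈C D → b ∈C D →
             ∀ u v → CycleEdge C u v ⇔ CycleEdge D u v)

  Hinge : Fin n → Set
  Hinge x = (∃[ C ] x ∈C C) × 3 ≤ degree G x

  record ConnSubgraph : Set₁ where
    field
      V      : Fin n → Set
      E      : Fin n → Fin n → Set
      E-adj  : ∀ {x y} → E x y → Adj G x y × V x × V y
      E-sym  : ∀ {x y} → E x y → E y x
      conn   : ∀ x y → V x → V y → Walk E x y

  -- DFS rule: the vertex x visited at step dfn x is an unvisited neighbour
  -- of father x, where father x is the most recently visited vertex that
  -- still has an unvisited neighbour (the top of the DFS stack).
  record IsDFS (r : Fin n) (dfn : Fin n → Fin n) (father : Fin n → Fin n) : Set where
    field
      dfn-inj  : Injective _≡_ _≡_ dfn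
      dfn-root : toℕ (dfn r) ≡ 0
      father-adj : ∀ x → x ≢ r → Adj G (father x) x
      father-before : ∀ x → x ≢ r → toℕ (dfn (father x)) < toℕ (dfn x)
      father-top : ∀ x → x ≢ r → ∀ z → toℕ (dfn z) < toℕ (dfn x) →
                   (∃[ y ] (Adj G z y × toℕ (dfn x) ≤ toℕ (dfn y))) →
                   toℕ (dfn z) ≤ toℕ (dfn (father x))

  IsRoot : (Fin n → Fin n) → Cycle → Fin n → Set
  IsRoot dfn C y = y ∈C C × (∀ z → z ∈C C → toℕ (dfn y) ≤ toℕ (dfn z))

IsLast : ∀ {n} → (Fin n → Fin n) → Fin n → Set
IsLast dfn l = ∀ x → toℕ (dfn x) ≤ toℕ (dfn l)

module Submission where

-- The proof rests on two facts about DFS trees.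
--   * Stack lemma: a vertex z visited before x which still has a neighbour
--     visited no earlier than x is an ancestor of x.  Hence every neighbour
--     of l is an ancestor of l, and every non-tree edge joins a vertex to
--     one of its ancestors (a back edge).
--   * A back edge a–b closes the fundamental cycle made of the tree path
--     from b up to a; its vertices are exactly those between a and b.
-- In a cactus, a cycle meeting that tree path in two vertices has the same
-- vertex set.  For (1), the cycle neighbour y ≠ FATHER(l) of l spans a back
-- edge whose fundamental cycle shares y and l with C, so C is the tree path
-- from l up to y and y has the smallest DFN.  For (2), two back edges into l
-- would give two fundamental cycles sharing l and FATHER(l), forcing their
-- lower ends to coincide.  For (3), consider the branch of w away from its child v: the descendants
-- of w outside the subtree of v.  An edge from it to a vertex off C that
-- left it would close a cycle through two vertices of C, so walks in the
-- subcactus stay in the branch; and the subtree of v is a DFN-suffix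
-- because v is an ancestor of l.

open import Defs
open import Data.Nat using (ℕ; _≤_; _<_; z≤n; s≤s)
open import Data.Nat.Properties
  using (<-cmp; ≰⇒>; <⇒≢; <⇒≤; <⇒≱; ≤-<-trans; ≤∧≢⇒<; ≤-antisym; ≤-trans; ≤-refl; m≤n⇒m<n∨m≡n)
open import Data.Nat.Induction using (<-wellFounded)
open import Induction.WellFounded using (Acc; acc)
open import Data.Fin using (Fin; toℕ; _≟_)
open import Data.Fin.Properties using (toℕ-injective)
open import Data.Product using (Σ; _×_; _,_; proj₁; proj₂)
open import Data.Sum using (_⊎_; inj₁; inj₂)
open import Data.Empty using (⊥-elim)
open import Data.Bool using (T)
open import Data.Bool.Properties using (T?)
open import Data.List using (List; []; _∷_; _++_; [_]; length; filter; allFin)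
open import Data.List.Properties using (++-assoc; ∷-injectiveʳ)
open import Data.List.Membership.Propositional using (_∈_)
open import Data.List.Membership.Propositional.Properties using (∈-∃++; ∈-++⁺ʳ; ∈-++⁺ˡ; ∈-++⁻; ∈-filter⁻)
open import Data.List.Relation.Unary.Any using (here; there)
open import Data.List.Relation.Unary.All as All using ([]; _∷_)
open import Data.List.Relation.Unary.AllPairs using ([]; _∷_)
open import Data.List.Relation.Unary.Unique.Propositional using (Unique)
open import Data.List.Relation.Unary.Unique.Propositional.Properties using (allFin⁺; filter⁺)
open import Function using (Equivalence)
open import Relation.Binary.Definitions using (DecidableEquality; tri<; tri≈; tri>)
open import Relation.Nullary using (¬_; yes; no)
open import Relation.Binary.PropositionalEquality using (_≡_; _≢_; refl; sym; trans; cong; subst; ≢-sym)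

module ListFacts {A : Set} where

  Consecutive : A → A → List A → Set
  Consecutive u v ws = Σ (List A) λ as → Σ (List A) λ bs → ws ≡ as ++ u ∷ v ∷ bs

  closedWalk : A → List A → List A
  closedWalk x xs = x ∷ xs ++ [ x ]

  consecutive-∈ : ∀ {u v ws} → Consecutive u v ws → u ∈ ws × v ∈ ws
  consecutive-∈ (as , bs , refl) = ∈-++⁺ʳ as (here refl) , ∈-++⁺ʳ as (there (here refl))

  closedWalk-∈ : ∀ {x xs z} → z ∈ closedWalk x xs → z ∈ x ∷ xs
  closedWalk-∈ (here z≡x) = here z≡x
  closedWalk-∈ {xs = xs} (there z∈) with ∈-++⁻ xs z∈
  ... | inj₁ z∈xs = there z∈xs
  ... | inj₂ (here z≡x) = here z≡x

  unique-++-distinct : ∀ (xs : List A) {ys x y} → Unique (xs ++ ys) → x ∈ xs → y ∈ ys → x ≢ y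
  unique-++-distinct (_ ∷ xs) (x∉ ∷ _) (here refl) y∈ = All.lookup x∉ (∈-++⁺ʳ xs y∈)
  unique-++-distinct (_ ∷ xs) (_ ∷ uniq) (there x∈) y∈ = unique-++-distinct xs uniq x∈ y∈

  successor : ∀ (f : A) L {z} → z ∈ L → Σ A λ s → Consecutive z s (L ++ [ f ])
  successor f (x ∷ []) (here refl) = f , [] , [] , refl
  successor f (x ∷ y ∷ L) (here refl) = y , [] , L ++ [ f ] , refl
  successor f (x ∷ L) (there z∈) =
    let (s , as , bs , split) = successor f L z∈ in s , x ∷ as , bs , cong (x ∷_) split

  predecessor : ∀ (x : A) X l T → Σ A λ p → p ∈ x ∷ X × Consecutive p l ((x ∷ X) ++ l ∷ T)
  predecessor x [] l T = x , here refl , [] , T , refl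
  predecessor x (x′ ∷ X) l T =
    let (p , p∈ , as , bs , split) = predecessor x′ X l T
    in p , there p∈ , x ∷ as , bs , cong (x ∷_) split

  record TwoNeighbours (l : A) (ws : List A) : Set where
    field
      before after : A
      distinct     : before ≢ after
      precedes     : Consecutive before l ws
      follows      : Consecutive l after ws

  -- Split f ∷ rest around l and read off the neighbours on both sides; the
  -- length bound rules out the cases where they would coincide.
  private
    around : ∀ {f : A} {rest} l ls rs → f ∷ rest ≡ ls ++ l ∷ rs → Unique (f ∷ rest) →
             2 ≤ length rest → TwoNeighbours l (closedWalk f rest)
    around l [] [] refl _ ()
    around l [] (_ ∷ []) refl _ (s≤s ())
    around l [] (b₁ ∷ b₂ ∷ rs) refl (_ ∷ b₁∉ ∷ _) _ =
      let (p , p∈ , as , bs , split) = predecessor b₂ rs l []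
      in record { before = p ; after = b₁ ; distinct = λ p≡b₁ → All.lookup b₁∉ p∈ (sym p≡b₁)
                ; precedes = l ∷ b₁ ∷ as , bs , cong (λ t → l ∷ b₁ ∷ t) split
                ; follows = [] , b₂ ∷ rs ++ [ l ] , refl }
    around l (a ∷ []) [] refl _ (s≤s ())
    around l (a ∷ []) (b ∷ rs) refl ((_ ∷ a≢b ∷ _) ∷ _) _ =
      record { before = a ; after = b ; distinct = a≢b
             ; precedes = [] , b ∷ rs ++ [ a ] , refl ; follows = [ a ] , rs ++ [ a ] , refl }
    around l (a ∷ a₂ ∷ ls) rs refl (a∉ ∷ uniq) _ = aroundTail rs uniq
      where
      reassoc : ∀ rs → closedWalk a (a₂ ∷ ls ++ l ∷ rs) ≡ a ∷ (a₂ ∷ ls) ++ l ∷ (rs ++ [ a ])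
      reassoc rs = cong (a ∷_) (++-assoc (a₂ ∷ ls) (l ∷ rs) [ a ])

      beforeL : ∀ rs → Σ A λ p → p ∈ a₂ ∷ ls × Consecutive p l (closedWalk a (a₂ ∷ ls ++ l ∷ rs))
      beforeL rs =
        let (p , p∈ , as , bs , split) = predecessor a₂ ls l (rs ++ [ a ])
        in p , p∈ , a ∷ as , bs , trans (reassoc rs) (cong (a ∷_) split)

      aroundTail : ∀ rs → Unique ((a₂ ∷ ls) ++ l ∷ rs) → TwoNeighbours l (closedWalk a (a₂ ∷ ls ++ l ∷ rs))
      aroundTail [] _ =
        let (p , p∈ , p-l) = beforeL [] in
        record { before = p ; after = a ; distinct = λ p≡a → All.lookup a∉ (∈-++⁺ˡ p∈) (sym p≡a)
               ; precedes = p-l ; follows = a ∷ a₂ ∷ ls , [] , reassoc [] }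
      aroundTail (b ∷ rs) uniq =
        let (p , p∈ , p-l) = beforeL (b ∷ rs) in
        record { before = p ; after = b
               ; distinct = unique-++-distinct (a₂ ∷ ls) uniq p∈ (there (here refl))
               ; precedes = p-l ; follows = a ∷ a₂ ∷ ls , rs ++ [ a ] , reassoc (b ∷ rs) }

  twoNeighbours : ∀ (f : A) rest {l} → Unique (f ∷ rest) → 2 ≤ length rest → l ∈ f ∷ rest →
                  TwoNeighbours l (closedWalk f rest)
  twoNeighbours f rest {l} uniq long l∈ =
    let (ls , rs , split) = ∈-∃++ l∈ in around l ls rs split uniq long

  twoAvoiding : DecidableEquality A → ∀ L → Unique L → 3 ≤ length L → ∀ e →
                Σ A λ x → Σ A λ y → x ∈ L × y ∈ L × x ≢ y × x ≢ e × y ≢ e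
  twoAvoiding _ [] _ () _
  twoAvoiding _ (a ∷ []) _ (s≤s ()) _
  twoAvoiding _ (a ∷ b ∷ []) _ (s≤s (s≤s ())) _
  twoAvoiding _≟ₐ_ (a ∷ b ∷ c ∷ L) ((a≢b ∷ a≢c ∷ _) ∷ (b≢c ∷ _) ∷ _) _ e with a ≟ₐ e | b ≟ₐ e
  ... | yes refl | _ = b , c , there (here refl) , there (there (here refl)) , b≢c , ≢-sym a≢b , ≢-sym a≢c
  ... | no a≢e | yes refl = a , c , here refl , there (there (here refl)) , a≢c , a≢e , ≢-sym b≢c
  ... | no a≢e | no b≢e = a , b , here refl , there (here refl) , a≢b , a≢e , b≢e

open ListFacts

module GraphFacts {n : ℕ} (G : Graph n) where
  open Graph G using (adj; irrefl)

  infix 4 _~_ _∈ᶜ_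

  _~_ : Fin n → Fin n → Set
  x ~ y = Adj G x y

  _∈ᶜ_ : Fin n → Cycle G → Set
  x ∈ᶜ C = _∈C_ G x C

  ~-sym : ∀ {x y} → x ~ y → y ~ x
  ~-sym {x} {y} = subst T (Graph.sym G x y)

  ~-irrefl : ∀ {x y} → x ~ y → x ≢ y
  ~-irrefl {x} x~x refl = subst T (irrefl x) x~x

  chain-~ : ∀ {ws u v} → Chain G ws → Consecutive u v ws → u ~ v
  chain-~ {[]} _ ([] , _ , ())
  chain-~ {[]} _ (_ ∷ _ , _ , ())
  chain-~ {_ ∷ _} (cons _ _ _ u~v _) ([] , _ , refl) = u~v
  chain-~ {_ ∷ _} chain (_ ∷ as , bs , split) = chain-~ (chain-tail chain) (as , bs , ∷-injectiveʳ split)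
    where
    chain-tail : ∀ {x xs} → Chain G (x ∷ xs) → Chain G xs
    chain-tail (one _) = nil
    chain-tail (cons _ _ _ _ chain) = chain

  cycleEdge-~ : ∀ (C : Cycle G) {u v} → CycleEdge G C u v → u ~ v
  cycleEdge-~ C (inj₁ uv) = chain-~ (Cycle.closed C) uv
  cycleEdge-~ C (inj₂ vu) = ~-sym (chain-~ (Cycle.closed C) vu)

  cycleEdge-∈ᶜ : ∀ (C : Cycle G) {u v} → CycleEdge G C u v → u ∈ᶜ C × v ∈ᶜ C
  cycleEdge-∈ᶜ C (inj₁ uv) =
    let (u∈ , v∈) = consecutive-∈ uv in closedWalk-∈ u∈ , closedWalk-∈ v∈
  cycleEdge-∈ᶜ C (inj₂ vu) =
    let (v∈ , u∈) = consecutive-∈ vu in closedWalk-∈ u∈ , closedWalk-∈ v∈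

  cycleEdge-at : ∀ (C : Cycle G) {z} → z ∈ᶜ C → Σ (Fin n) λ s → CycleEdge G C z s
  cycleEdge-at C z∈ =
    let (s , zs) = successor (Cycle.first C) (Cycle.first C ∷ Cycle.rest C) z∈ in s , inj₁ zs

  cactus-sameVertices : Cactus G → ∀ (C D : Cycle G) {a b} → a ≢ b →
                        a ∈ᶜ C → b ∈ᶜ C → a ∈ᶜ D → b ∈ᶜ D → ∀ {z} → z ∈ᶜ C → z ∈ᶜ D
  cactus-sameVertices (_ , sameEdges) C D a≢b aC bC aD bD {z} zC =
    let (s , zs) = cycleEdge-at C zC
    in proj₁ (cycleEdge-∈ᶜ D (Equivalence.to (sameEdges C D _ _ a≢b aC bC aD bD z s) zs))

  neighbours : Fin n → List (Fin n)
  neighbours x = filter (λ y → T? (adj x y)) (allFin n)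

  neighbour-~ : ∀ {x y} → y ∈ neighbours x → y ~ x
  neighbour-~ {x} y∈ = ~-sym (proj₂ (∈-filter⁻ (λ y → T? (adj x y)) {xs = allFin n} y∈))

  twoNeighboursAvoiding : ∀ {x} → 3 ≤ degree G x → ∀ e →
    Σ (Fin n) λ a → Σ (Fin n) λ b → a ≢ b × a ≢ e × b ≢ e × a ~ x × b ~ x
  twoNeighboursAvoiding {x} deg e =
    let (a , b , a∈ , b∈ , a≢b , a≢e , b≢e) =
          twoAvoiding _≟_ (neighbours x) (filter⁺ (λ y → T? (adj x y)) (allFin⁺ n)) deg e
    in a , b , a≢b , a≢e , b≢e , neighbour-~ a∈ , neighbour-~ b∈

module DFSTree {n : ℕ} (G : Graph n) {r : Fin n} {dfn father : Fin n → Fin n}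
               (dfs : IsDFS G r dfn father) where
  open IsDFS dfs
  open GraphFacts G

  pos : Fin n → ℕ
  pos x = toℕ (dfn x)

  pos-injective : ∀ {x y} → pos x ≡ pos y → x ≡ y
  pos-injective p = dfn-inj (toℕ-injective p)

  father-< : ∀ {y} → y ≢ r → pos (father y) < pos y
  father-< {y} = father-before y

  infix 4 _≼_
  data _≼_ : Fin n → Fin n → Set where
    ≼-refl  : ∀ {x} → x ≼ x
    ≼-child : ∀ {a y} → y ≢ r → a ≼ father y → a ≼ y

  father-≼ : ∀ {y} → y ≢ r → father y ≼ y
  father-≼ y≢r = ≼-child y≢r ≼-refl

  ≼-pos : ∀ {a b} → a ≼ b → pos a ≤ pos b
  ≼-pos ≼-refl = ≤-refl
  ≼-pos (≼-child y≢r a≼fy) = ≤-trans (≼-pos a≼fy) (<⇒≤ (father-< y≢r))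

  ≼-trans : ∀ {a b c} → a ≼ b → b ≼ c → a ≼ c
  ≼-trans a≼b ≼-refl = a≼b
  ≼-trans a≼b (≼-child c≢r b≼fc) = ≼-child c≢r (≼-trans a≼b b≼fc)

  ≼-antisym : ∀ {a b} → a ≼ b → b ≼ a → a ≡ b
  ≼-antisym a≼b b≼a = pos-injective (≤-antisym (≼-pos a≼b) (≼-pos b≼a))

  ≼-strict : ∀ {a b} → a ≼ b → a ≢ b → b ≢ r × a ≼ father b
  ≼-strict ≼-refl a≢a = ⊥-elim (a≢a refl)
  ≼-strict (≼-child b≢r a≼fb) _ = b≢r , a≼fb

  ≼-chain : ∀ {a b x} → a ≼ x → b ≼ x → a ≼ b ⊎ b ≼ a
  ≼-chain ≼-refl b≼a = inj₂ b≼a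
  ≼-chain (≼-child x≢r a≼fx) ≼-refl = inj₁ (≼-child x≢r a≼fx)
  ≼-chain (≼-child _ a≼fx) (≼-child _ b≼fx) = ≼-chain a≼fx b≼fx

  -- Stack lemma: if z is visited before x and has a neighbour u visited no
  -- earlier than x, then z is still on the DFS stack when x is visited,
  -- i.e. z is an ancestor of x.
  stackLemma : ∀ {x z u} → pos z < pos x → z ~ u → pos x ≤ pos u → z ≼ x
  stackLemma {x} {z} {u} z<x z~u x≤u = go x (<-wellFounded (pos x)) z<x x≤u
    where
    go : ∀ x → Acc _<_ (pos x) → pos z < pos x → pos x ≤ pos u → z ≼ x
    go x (acc smaller) z<x x≤u with x ≟ r
    ... | yes refl = ⊥-elim (<⇒≱ z<x (subst (_≤ pos z) (sym dfn-root) z≤n))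
    ... | no x≢r with <-cmp (pos z) (pos (father x))
    ...   | tri< z<fx _ _ = ≼-child x≢r
            (go (father x) (smaller (father-< x≢r)) z<fx (≤-trans (<⇒≤ (father-< x≢r)) x≤u))
    ...   | tri≈ _ z=fx _ = ≼-child x≢r (subst (z ≼_) (pos-injective z=fx) ≼-refl)
    ...   | tri> _ _ fx<z = ⊥-elim (<⇒≱ fx<z (father-top x x≢r z z<x (u , z~u , x≤u)))

  SuffixRooted : Fin n → Set
  SuffixRooted y = ∀ x → pos y ≤ pos x → y ≼ x

  -- A vertex x visited after father y is either y, after y (then below y),
  -- or strictly between them; in the last case the stack lemma applies to
  -- father y and its neighbour y.
  suffixRooted-father : ∀ {y} → y ≢ r → SuffixRooted y → SuffixRooted (father y)
  suffixRooted-father {y} y≢r rooted x fy≤x with <-cmp (pos x) (pos y)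
  ... | tri≈ _ x=y _ = subst (father y ≼_) (sym (pos-injective x=y)) (father-≼ y≢r)
  ... | tri> _ _ y<x = ≼-trans (father-≼ y≢r) (rooted x (<⇒≤ y<x))
  ... | tri< x<y _ _ with m≤n⇒m<n∨m≡n fy≤x
  ...   | inj₁ fy<x = stackLemma fy<x (father-adj y y≢r) (<⇒≤ x<y)
  ...   | inj₂ fy=x = subst (father y ≼_) (pos-injective fy=x) ≼-refl

  suffixRooted-ancestor : ∀ {a y} → a ≼ y → SuffixRooted y → SuffixRooted a
  suffixRooted-ancestor ≼-refl rooted = rooted
  suffixRooted-ancestor (≼-child y≢r a≼fy) rooted =
    suffixRooted-ancestor a≼fy (suffixRooted-father y≢r rooted)

  Between : Fin n → Fin n → Fin n → Set
  Between a b z = a ≼ z × z ≼ b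

  pathAbove : ∀ {a y} → a ≼ y → List (Fin n)
  pathAbove ≼-refl = []
  pathAbove (≼-child {y = y} _ a≼fy) = father y ∷ pathAbove a≼fy

  path-between : ∀ {a y z} (a≼y : a ≼ y) → z ∈ y ∷ pathAbove a≼y → Between a y z
  path-between a≼y (here refl) = a≼y , ≼-refl
  path-between (≼-child y≢r a≼fy) (there z∈) =
    let (a≼z , z≼fy) = path-between a≼fy z∈ in a≼z , ≼-trans z≼fy (father-≼ y≢r)

  between-path : ∀ {a y z} (a≼y : a ≼ y) → Between a y z → z ∈ y ∷ pathAbove a≼y
  between-path ≼-refl (a≼z , z≼a) = here (≼-antisym z≼a a≼z)
  between-path {z = z} (≼-child {y = y} _ a≼fy) (a≼z , z≼y) with z ≟ y
  ... | yes z≡y = here z≡y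
  ... | no z≢y = there (between-path a≼fy (a≼z , proj₂ (≼-strict z≼y z≢y)))

  -- Positions strictly decrease up the path, so it has no repetition.
  path-unique : ∀ {a y} (a≼y : a ≼ y) → Unique (y ∷ pathAbove a≼y)
  path-unique ≼-refl = [] ∷ []
  path-unique (≼-child {y = y} y≢r a≼fy) = All.tabulate above-y ∷ path-unique a≼fy
    where
    above-y : ∀ {z} → z ∈ pathAbove (≼-child y≢r a≼fy) → y ≢ z
    above-y z∈ y≡z = <⇒≢ (≤-<-trans (≼-pos (proj₂ (path-between a≼fy z∈))) (father-< y≢r))
                         (cong pos (sym y≡z))

  path-chain : ∀ {a y b} (a≼y : a ≼ y) → a ~ b → Chain G (y ∷ pathAbove a≼y ++ [ b ])
  path-chain {a} {b = b} ≼-refl a~b = cons a b [] a~b (one b)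
  path-chain {b = b} (≼-child {y = y} y≢r a≼fy) a~b =
    cons y (father y) (pathAbove a≼fy ++ [ b ]) (~-sym (father-adj y y≢r)) (path-chain a≼fy a~b)

  path-long : ∀ {a b} (a≼b : a ≼ b) → a ≢ b → a ≢ father b → 2 ≤ length (pathAbove a≼b)
  path-long ≼-refl a≢b _ = ⊥-elim (a≢b refl)
  path-long (≼-child _ ≼-refl) _ a≢fb = ⊥-elim (a≢fb refl)
  path-long (≼-child _ (≼-child _ _)) _ _ = s≤s (s≤s z≤n)

  record BackEdge (a b : Fin n) : Set where
    constructor backEdge
    field
      ancestor  : a ≼ b
      notFather : a ≢ father b
      adjacent  : a ~ b

  backEdgeCycle : ∀ {a b} → BackEdge a b → Cycle G
  backEdgeCycle {b = b} (backEdge a≼b a≢fb a~b) = record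
    { first = b ; rest = pathAbove a≼b ; long = path-long a≼b (~-irrefl a~b) a≢fb
    ; uniq = path-unique a≼b ; closed = path-chain a≼b a~b }

  backEdgeCycle-between : ∀ {a b z} (e : BackEdge a b) → z ∈ᶜ backEdgeCycle e → Between a b z
  backEdgeCycle-between (backEdge a≼b _ _) = path-between a≼b

  between-backEdgeCycle : ∀ {a b z} (e : BackEdge a b) → Between a b z → z ∈ᶜ backEdgeCycle e
  between-backEdgeCycle (backEdge a≼b _ _) = between-path a≼b

  InBranch : Fin n → Fin n → Fin n → Set
  InBranch w v x = w ≼ x × ¬ (v ≼ x)

  module InCactus (cac : Cactus G) where

    module _ {a b} (e : BackEdge a b) (C : Cycle G) {p q} (p≢q : p ≢ q)
             (p-between : Between a b p) (q-between : Between a b q) (pC : p ∈ᶜ C) (qC : q ∈ᶜ C) where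

      cycle⊆treePath : ∀ {z} → z ∈ᶜ C → Between a b z
      cycle⊆treePath zC = backEdgeCycle-between e
        (cactus-sameVertices cac C (backEdgeCycle e) p≢q pC qC
          (between-backEdgeCycle e p-between) (between-backEdgeCycle e q-between) zC)

      treePath⊆cycle : ∀ {z} → Between a b z → z ∈ᶜ C
      treePath⊆cycle z-between = cactus-sameVertices cac (backEdgeCycle e) C p≢q
        (between-backEdgeCycle e p-between) (between-backEdgeCycle e q-between) pC qC
        (between-backEdgeCycle e z-between)

    -- Then an
    -- edge from the branch of w away from v to a vertex off C stays in the
    -- branch: leaving it would close a cycle through two vertices of C.
    module Branch (C : Cycle G) {w v} (v≢r : v ≢ r) (w≡fv : w ≡ father v) (w≢r : w ≢ r)
                  (vC : v ∈ᶜ C) (wC : w ∈ᶜ C) (fwC : father w ∈ᶜ C) where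

      w<v : pos w < pos v
      w<v = subst (λ t → pos t < pos v) (sym w≡fv) (father-< v≢r)

      w-inBranch : InBranch w v w
      w-inBranch = ≼-refl , λ v≼w → <⇒≱ w<v (≼-pos v≼w)

      -- The edge x–z goes down the tree (x ≼ z): if z descended from v, then
      -- x = w and w–z would be a back edge whose cycle passes through v.
      descend : ∀ {x z} → InBranch w v x → ¬ z ∈ᶜ C → x ~ z → x ≼ z → InBranch w v z
      descend {x} {z} (w≼x , v⋠x) z∉C x~z x≼z = ≼-trans w≼x x≼z , v⋠z
        where
        w≼v : w ≼ v
        w≼v = subst (_≼ v) (sym w≡fv) (father-≼ v≢r)

        w≢v : w ≢ v
        w≢v w≡v = <⇒≢ w<v (cong pos w≡v)

        ancestorOfV : x ≼ v → x ≡ w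
        ancestorOfV x≼v = ≼-antisym (subst (x ≼_) (sym w≡fv) (proj₂ (≼-strict x≼v x≢v))) w≼x
          where
          x≢v : x ≢ v
          x≢v refl = v⋠x ≼-refl

        backEdgeFromW : v ≼ z → x ≡ w → BackEdge w z
        backEdgeFromW v≼z refl = backEdge x≼z w≢fz x~z
          where
          w≢fz : w ≢ father z
          w≢fz w≡fz = <⇒≱ w<v (subst (λ t → pos v ≤ pos t) (sym w≡fz)
                        (≼-pos (proj₂ (≼-strict v≼z (λ v≡z → z∉C (subst (_∈ᶜ C) v≡z vC))))))

        v⋠z : ¬ v ≼ z
        v⋠z v≼z with ≼-chain v≼z x≼z
        ... | inj₁ v≼x = v⋠x v≼x
        ... | inj₂ x≼v = z∉C (treePath⊆cycle (backEdgeFromW v≼z x≡w) C w≢v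
                               (≼-refl , w≼z) (w≼v , v≼z) wC vC (w≼z , ≼-refl))
          where
          x≡w : x ≡ w
          x≡w = ancestorOfV x≼v
          w≼z : w ≼ z
          w≼z = subst (_≼ z) x≡w x≼z

      -- The edge x–z goes up the tree (z ≼ x): z descends from w, for
      -- otherwise z–x would be a back edge whose cycle passes through w and
      -- father w.
      ascend : ∀ {x z} → InBranch w v x → ¬ z ∈ᶜ C → x ~ z → z ≼ x → InBranch w v z
      ascend {x} {z} (w≼x , v⋠x) z∉C x~z z≼x with ≼-chain w≼x z≼x
      ... | inj₁ w≼z = w≼z , λ v≼z → v⋠x (≼-trans v≼z z≼x)
      ... | inj₂ z≼w = ⊥-elim (z∉C (treePath⊆cycle edge C fw≢w
                         (z≼fw , ≼-trans (father-≼ w≢r) w≼x) (z≼w , w≼x) fwC wC (≼-refl , z≼x)))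
        where
        z≢w : z ≢ w
        z≢w z≡w = z∉C (subst (_∈ᶜ C) (sym z≡w) wC)
        z≼fw : z ≼ father w
        z≼fw = proj₂ (≼-strict z≼w z≢w)
        fw≢w : father w ≢ w
        fw≢w fw≡w = <⇒≢ (father-< w≢r) (cong pos fw≡w)
        z≢fx : z ≢ father x
        z≢fx z≡fx with x ≟ w
        ... | yes refl = z∉C (subst (_∈ᶜ C) (sym z≡fx) fwC)
        ... | no x≢w = z≢w (≼-antisym z≼w w≼z)
          where
          w≼z : w ≼ z
          w≼z = subst (w ≼_) (sym z≡fx) (proj₂ (≼-strict w≼x (≢-sym x≢w)))
        edge : BackEdge z x
        edge = backEdge z≼x z≢fx (~-sym x~z)

      branch-step : ∀ {x z} → InBranch w v x → ¬ z ∈ᶜ C → x ~ z → InBranch w v z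
      branch-step {x} {z} x∈B z∉C x~z with <-cmp (pos x) (pos z)
      ... | tri< x<z _ _ = descend x∈B z∉C x~z (stackLemma x<z x~z ≤-refl)
      ... | tri≈ _ x=z _ = ⊥-elim (~-irrefl x~z (pos-injective x=z))
      ... | tri> _ _ z<x = ascend x∈B z∉C x~z (stackLemma z<x (~-sym x~z) ≤-refl)

      branch-walk : (K : ConnSubgraph G) → (∀ u → u ∈ᶜ C → ConnSubgraph.V K u → u ≡ w) →
                    ∀ {x y} → Walk (ConnSubgraph.E K) x y → InBranch w v x → InBranch w v y
      branch-walk K onlyW here x∈B = x∈B
      branch-walk K onlyW (step {y = z} xz walk) x∈B with ConnSubgraph.E-adj K xz | z ≟ w
      ... | _ , _ , _ | yes refl = branch-walk K onlyW walk w-inBranch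
      ... | x~z , _ , Kz | no z≢w =
        branch-walk K onlyW walk (branch-step x∈B (λ zC → z≢w (onlyW z zC Kz)) x~z)

module LastVertex {n : ℕ} (G : Graph n) (cac : Cactus G) {r : Fin n} {dfn father : Fin n → Fin n}
                  (dfs : IsDFS G r dfn father) {l : Fin n} (last : IsLast dfn l)
                  (C : Cycle G) (lC : _∈C_ G l C) where
  open IsDFS dfs
  open GraphFacts G
  open DFSTree G dfs
  open InCactus cac

  -- Every neighbour of the last vertex is visited before it, so by the
  -- stack lemma it is an ancestor of l.
  neighbour-≼ : ∀ {a} → a ~ l → a ≼ l
  neighbour-≼ {a} a~l = stackLemma a<l a~l ≤-refl
    where
    a<l : pos a < pos l
    a<l = ≤∧≢⇒< (last a) (λ a=l → ~-irrefl a~l (pos-injective a=l))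

  last-suffixRooted : SuffixRooted l
  last-suffixRooted x l≤x = subst (l ≼_) (pos-injective (≤-antisym l≤x (last x))) ≼-refl

  lastBackEdge : ∀ {a} → a ~ l → a ≢ father l → BackEdge a l
  lastBackEdge a~l a≢fl = backEdge (neighbour-≼ a~l) a≢fl a~l

  module CycleAtLast {y} (l–y : CycleEdge G C l y) (y≢fl : y ≢ father l) where
    y~l : y ~ l
    y~l = ~-sym (cycleEdge-~ C l–y)

    yC : y ∈ᶜ C
    yC = proj₂ (cycleEdge-∈ᶜ C l–y)

    private
      edge : BackEdge y l
      edge = lastBackEdge y~l y≢fl

      y≼l : y ≼ l
      y≼l = BackEdge.ancestor edge

    cycle⊆path : ∀ {z} → z ∈ᶜ C → Between y l z
    cycle⊆path = cycle⊆treePath edge C (~-irrefl y~l) (≼-refl , y≼l) (y≼l , ≼-refl) yC lC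

    path⊆cycle : ∀ {z} → Between y l z → z ∈ᶜ C
    path⊆cycle = treePath⊆cycle edge C (~-irrefl y~l) (≼-refl , y≼l) (y≼l , ≼-refl) yC lC

    y-root : IsRoot G dfn C y
    y-root = yC , λ z zC → ≼-pos (proj₁ (cycle⊆path zC))

  cycleNeighbourIsRoot : ∀ y → CycleEdge G C l y → y ≢ father l → IsRoot G dfn C y
  cycleNeighbourIsRoot y l–y y≢fl = CycleAtLast.y-root l–y y≢fl

  -- Back edges a–l and b–l with a ≼ b coincide: the cycle of a–l shares l
  -- and father l with the tree path from l up to b, so it lies on that path
  -- and b ≼ a.
  nestedBackEdgesToLast : ∀ {a b} → a ≼ b → BackEdge a l → BackEdge b l → a ≡ b
  nestedBackEdgesToLast {a} {b} a≼b ea eb =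
    ≼-antisym a≼b (proj₁ (cycle⊆treePath eb (backEdgeCycle ea) l≢fl
      (b≼l , ≼-refl) (b≼fl , father-≼ l≢r)
      (between-backEdgeCycle ea (a≼l , ≼-refl)) (between-backEdgeCycle ea (a≼fl , father-≼ l≢r))
      (between-backEdgeCycle ea (≼-refl , a≼l))))
    where
    a≼l : a ≼ l
    a≼l = BackEdge.ancestor ea
    b≼l : b ≼ l
    b≼l = BackEdge.ancestor eb
    l≢r : l ≢ r
    l≢r = proj₁ (≼-strict b≼l (~-irrefl (BackEdge.adjacent eb)))
    l≢fl : l ≢ father l
    l≢fl l≡fl = <⇒≢ (father-< l≢r) (cong pos (sym l≡fl))
    a≼fl : a ≼ father l
    a≼fl = proj₂ (≼-strict a≼l (~-irrefl (BackEdge.adjacent ea)))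
    b≼fl : b ≼ father l
    b≼fl = proj₂ (≼-strict b≼l (~-irrefl (BackEdge.adjacent eb)))

  -- At most one back edge ends at l, since the lower ends of two back
  -- edges into l are both ancestors of l, hence nested.
  backEdgeToLast-unique : ∀ {a b} → BackEdge a l → BackEdge b l → a ≡ b
  backEdgeToLast-unique ea eb with ≼-chain (BackEdge.ancestor ea) (BackEdge.ancestor eb)
  ... | inj₁ a≼b = nestedBackEdgesToLast a≼b ea eb
  ... | inj₂ b≼a = sym (nestedBackEdgesToLast b≼a eb ea)

  -- Part (2): three neighbours would give two back edges into l.
  lastNotHinge : ¬ Hinge G l
  lastNotHinge (_ , deg) with twoNeighboursAvoiding deg (father l)
  ... | a , b , a≢b , a≢fl , b≢fl , a~l , b~l =
    a≢b (backEdgeToLast-unique (lastBackEdge a~l a≢fl) (lastBackEdge b~l b≢fl))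

  -- l has two cycle neighbours, so one of them is not its father.
  module Around = TwoNeighbours
    (twoNeighbours (Cycle.first C) (Cycle.rest C) (Cycle.uniq C) (Cycle.long C) lC)

  cycleNeighbour : Σ (Fin n) λ y → CycleEdge G C l y × y ≢ father l
  cycleNeighbour with Around.after ≟ father l
  ... | yes after≡fl = Around.before , inj₂ Around.precedes
                     , λ before≡fl → Around.distinct (trans before≡fl (sym after≡fl))
  ... | no after≢fl = Around.after , inj₁ Around.follows , after≢fl

  -- Part (3): the subcactus K hangs in the branch of w away from v, which
  -- starts at w and ends before v, since v's subtree is a DFN-suffix.
  subcactusBetween : ∀ w v → w ∈ᶜ C → v ∈ᶜ C → v ≢ r → w ≡ father v →
    ¬ IsRoot G dfn C w → (K : ConnSubgraph G) → ConnSubgraph.V K w →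
    (∀ u → u ∈ᶜ C → ConnSubgraph.V K u → u ≡ w) →
    ∀ v′ → ConnSubgraph.V K v′ → pos w ≤ pos v′ × pos v′ < pos v
  subcactusBetween w v wC vC v≢r w≡fv notRoot K Kw onlyW v′ Kv′ =
    ≼-pos w≼v′ , ≰⇒> λ v≤v′ → v⋠v′ (suffixRooted-ancestor v≼l last-suffixRooted v′ v≤v′)
    where
    y : Fin n
    y = proj₁ cycleNeighbour
    open CycleAtLast (proj₁ (proj₂ cycleNeighbour)) (proj₂ (proj₂ cycleNeighbour))

    w≢r : w ≢ r
    w≢r refl = notRoot (wC , λ z _ → subst (_≤ pos z) (sym dfn-root) z≤n)

    -- w lies strictly below the root y of C, so father w is on C as well.
    y≼w : y ≼ w
    y≼w = proj₁ (cycle⊆path wC)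
    y≢w : y ≢ w
    y≢w refl = notRoot y-root
    fwC : father w ∈ᶜ C
    fwC = path⊆cycle (proj₂ (≼-strict y≼w y≢w) , ≼-trans (father-≼ w≢r) (proj₂ (cycle⊆path wC)))

    v≼l : v ≼ l
    v≼l = proj₂ (cycle⊆path vC)

    open Branch C v≢r w≡fv w≢r vC wC fwC
    v′-inBranch : InBranch w v v′
    v′-inBranch = branch-walk K onlyW (ConnSubgraph.conn K w v′ Kw Kv′) w-inBranch
    w≼v′ : w ≼ v′
    w≼v′ = proj₁ v′-inBranch
    v⋠v′ : ¬ v ≼ v′
    v⋠v′ = proj₂ v′-inBranch

mainTheorem2 : ∀ {n} (G : Graph n) → Cactus G →
    (r : Fin n) (dfn : Fin n → Fin n) (father : Fin n → Fin n) → IsDFS G r dfn father →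
    (l : Fin n) → IsLast dfn l → (C : Cycle G) → _∈C_ G l C →
    (∀ y → CycleEdge G C l y → y ≢ father l → IsRoot G dfn C y)
    × ¬ Hinge G l
    × (∀ w v → _∈C_ G w C → _∈C_ G v C → v ≢ r → w ≡ father v →
         ¬ IsRoot G dfn C w → Hinge G w →
         (K : ConnSubgraph G) → ConnSubgraph.V K w →
         (∀ u → _∈C_ G u C → ConnSubgraph.V K u → u ≡ w) →
         ∀ v′ → ConnSubgraph.V K v′ →
         toℕ (dfn w) ≤ toℕ (dfn v′) × toℕ (dfn v′) < toℕ (dfn v))
mainTheorem2 G cac r dfn father dfs l last C lC =
  cycleNeighbourIsRoot , lastNotHinge ,
  λ w v wC vC v≢r w≡fv notRoot _ → subcactusBetween w v wC vC v≢r w≡fv notRoot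
  where open LastVertex G cac dfs last C lC
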